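{- Let $m>1$ be an integer and let $\mathcal{F}_m$ be the Farey sequence of order $m$. (i) Let $\tfrac{h}{k}\in\mathcal{F}_m$ with $\tfrac{h}{k}\neq\tfrac{0}{1}$. Let $a$ and $b$ be integers such that $ka\equiv -1\pmod{h}$ with $\left\lceil\tfrac{hm}{k}\right\rceil-h\leq a\leq \left\lceil\tfrac{hm}{k}\right\rceil-1$, and $hb\equiv 1\pmod{k}$ with $m-k+1\leq b\leq m$. Then \[ a\Big/\tfrac{ka+1}{h}\;=\;\tfrac{hb-1}{k}\Big/ b, \] and this fraction immediately precedes $\tfrac{h}{k}$ in $\mathcal{F}_m$. (ii) Let $\tfrac{h}{k}\in\mathcal{F}_m$ with $\tfrac{h}{k}\neq\tfrac{1}{1}$. Let $a$ and $b$ be integers such that $ka\equiv 1\pmod{h}$ with $\left\lceil\tfrac{hm+2}{k}\right\rceil-h\leq a\leq \left\lceil\tfrac{hm+2}{k}\right\rceil-1$, and $hb\equiv -1\pmod{k}$ with $m-k+1\leq b\leq m$. Then \[ a\Big/\tfrac{ka-1}{h}\;=\;\tfrac{hb+1}{k}\Big/ b, \] and this fraction immediately succeeds $\tfrac{h}{k}$ in $\mathcal{F}_m$.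
   Context: For an integer $m>1$, the Farey sequence $\mathcal{F}_m$ of order $m$ is the ascending sequence of all rational numbers $\tfrac{h}{k}$ written in lowest terms ($\gcd(h,k)=1$) with $0\le \tfrac hk\le 1$ and $1\le k\le m$; fractions are identified with their reduced numerator/denominator pairs. A fraction "precedes" (resp. "succeeds") $\tfrac hk$ in the sequence if it is the element immediately before (resp. after) $\tfrac hk$. The notation $x\big/ y$ denotes the fraction with numerator $x$ and denominator $y$. -}

module Defs where

open import Data.Integer using (ℤ; +_; +[1+_]; -[1+_]; -_; _+_; _-_; _*_; _≤_; _<_; 0ℤ; 1ℤ)
open import Data.Integer.DivMod using (_/_)
open import Data.Integer.GCD using (gcd)
open import Data.Product using (_×_)
open import Relation.Binary.PropositionalEquality using (_≡_)
open import Relation.Nullary using (¬_)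

-- Integer division x ÷ y (Euclidean, i.e. floor division for y > 0);
-- the value for y = 0 is an irrelevant junk value 0.
-- In the statement it is only used where y ∣ x is also asserted, so it is exact division.
_÷_ : ℤ → ℤ → ℤ
x ÷ (+ 0)      = 0ℤ
x ÷ +[1+ n ]   = x / +[1+ n ]
x ÷ -[1+ n ]   = x / -[1+ n ]

infixl 7 _÷_

⌈_÷_⌉ : ℤ → ℤ → ℤ
⌈ x ÷ y ⌉ = - ((- x) ÷ y)

InFarey : ℤ → ℤ → ℤ → Set
InFarey m h k = (0ℤ ≤ h) × (h ≤ k) × (1ℤ ≤ k) × (k ≤ m) × (gcd h k ≡ 1ℤ)

FracLt : ℤ → ℤ → ℤ → ℤ → Set
FracLt x y u v = x * v < u * y

Precedes : ℤ → ℤ → ℤ → ℤ → ℤ → Set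
Precedes m x y h k =
  InFarey m x y × InFarey m h k × FracLt x y h k ×
  (∀ u v → InFarey m u v → ¬ (FracLt x y u v × FracLt u v h k))

Succeeds : ℤ → ℤ → ℤ → ℤ → ℤ → Set
Succeeds m x y h k = Precedes m h k x y

-- If h b − c k = ε with ε = ±1, then c/b and h/k are neighbours in F_m as soon as b + k > m:
-- a fraction u/v strictly between them has v = b (h v − u k) + k (u b − c v) ≥ b + k.
-- The bounds on b place c = (h b − ε)/k in the window of h consecutive integers prescribed
-- for a; since gcd(h,k) = 1, a and c both solve k t ≡ −ε (mod h), hence a = c.
module Submission where

open import Defs
open import Data.Integer using (ℤ; +_; +[1+_]; -_; _+_; _-_; _*_; _≤_; _<_; 0ℤ; 1ℤ; -1ℤ; +<+; suc)
open import Data.Integer.Base using (NonNegative; positive; nonNegative)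
open import Data.Integer.Coprimality using (coprime-divisor)
open import Data.Integer.Divisibility using (_∣_)
import Data.Integer.Divisibility.Signed as S
open import Data.Integer.DivMod using (_/_; _%_; [n/d]*d≤n; a≡a%n+[a/n]*n; n%d<d)
open import Data.Integer.GCD using (gcd; gcd[i,j]∣i; gcd[i,j]∣j; gcd-greatest)
open import Data.Integer.Properties
open import Data.Integer.Tactic.RingSolver using (solve)
open import Data.List using (_∷_; [])
open import Data.Nat.Coprimality using (gcd≡1⇒coprime)
import Data.Nat.Divisibility as ℕ
open import Data.Product using (_×_; _,_; proj₁; proj₂)
open import Relation.Binary.PropositionalEquality

private
  variable
    i j k h x c a b m u v y : ℤ

i<suc[j]⇒i≤j : i < suc j → i ≤ j
i<suc[j]⇒i≤j {j = j} p = subst (_ ≤_) (pred-suc j) (i<j⇒i≤pred[j] p)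

i<i+1 : ∀ i → i < i + 1ℤ
i<i+1 i = suc[i]≤j⇒i<j (≤-reflexive (+-comm 1ℤ i))

i<j⇒i≤j-1 : i < j → i ≤ j - 1ℤ
i<j⇒i≤j-1 {j = j} p = subst (_ ≤_) (+-comm -1ℤ j) (i<j⇒i≤pred[j] p)

i≤j+k⇒i-k≤j : i ≤ j + k → i - k ≤ j
i≤j+k⇒i-k≤j {i} {j} {k} p = begin
  i - k      ≤⟨ +-monoˡ-≤ (- k) p ⟩
  j + k - k  ≡⟨ solve (j ∷ k ∷ []) ⟩
  j          ∎
  where open ≤-Reasoning

i<j⇒1≤j-i : i < j → 1ℤ ≤ j - i
i<j⇒1≤j-i {i} {j} p = begin
  1ℤ          ≡⟨ solve (i ∷ []) ⟩
  1ℤ + i - i  ≤⟨ +-monoˡ-≤ (- i) (i<j⇒suc[i]≤j p) ⟩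
  j - i       ∎
  where open ≤-Reasoning

1≤i⇒0≤i : 1ℤ ≤ i → 0ℤ ≤ i
1≤i⇒0≤i p = <⇒≤ (suc[i]≤j⇒i<j p)

i≤j⇒1≤j-i+1 : i ≤ j → 1ℤ ≤ j - i + 1ℤ
i≤j⇒1≤j-i+1 p = +-monoˡ-≤ 1ℤ (i≤j⇒0≤j-i p)

1≤i*j : 1ℤ ≤ i → 1ℤ ≤ j → 1ℤ ≤ i * j
1≤i*j {i} {j} 1≤i 1≤j = begin
  1ℤ      ≤⟨ 1≤i ⟩
  i       ≡⟨ sym (*-identityʳ i) ⟩
  i * 1ℤ  ≤⟨ *-monoˡ-≤-nonNeg i {{nonNegative (1≤i⇒0≤i 1≤i)}} 1≤j ⟩
  i * j   ∎
  where open ≤-Reasoning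

m-k+1≤b⇒m<b+k : m - k + 1ℤ ≤ b → m < b + k
m-k+1≤b⇒m<b+k {m} {k} {b} bLo = suc[i]≤j⇒i<j (begin
  1ℤ + m            ≡⟨ solve (m ∷ k ∷ []) ⟩
  m - k + 1ℤ + k    ≤⟨ +-monoˡ-≤ k bLo ⟩
  b + k             ∎)
  where open ≤-Reasoning

-n<t*n<n⇒t≡0 : ∀ {n t} → 0ℤ < n → - n < t * n → t * n < n → t ≡ 0ℤ
-n<t*n<n⇒t≡0 {n} {t} 0<n -n<tn tn<n = ≤-antisym (i<j⇒i≤pred[j] t<1) (i<j⇒suc[i]≤j -1<t)
  where
  instance _ = nonNegative (<⇒≤ 0<n)
  t<1 : t < 1ℤ
  t<1 = *-cancelʳ-<-nonNeg n (subst (t * n <_) (sym (*-identityˡ n)) tn<n)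
  -1<t : -1ℤ < t
  -1<t = *-cancelʳ-<-nonNeg n (subst (_< t * n) (sym (-1*i≡-i n)) -n<tn)

[x÷k]*k≤x : ∀ x → 0ℤ < k → x ÷ k * k ≤ x
[x÷k]*k≤x {+[1+ n ]} x _ = [n/d]*d≤n x +[1+ n ]
[x÷k]*k≤x {+ 0} x (+<+ ())

x<suc[x÷k]*k : ∀ x → 0ℤ < k → x < suc (x ÷ k) * k
x<suc[x÷k]*k {k@(+[1+ _ ])} x _ = begin-strict
  x                      ≡⟨ a≡a%n+[a/n]*n x k ⟩
  + (x % k) + x / k * k  <⟨ +-monoˡ-< (x / k * k) (+<+ (n%d<d x k)) ⟩
  k + x / k * k          ≡⟨ sym (suc-* (x / k) k) ⟩
  suc (x / k) * k        ∎
  where open ≤-Reasoning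
x<suc[x÷k]*k {+ 0} x (+<+ ())

c*k≤x⇒c≤x÷k : ∀ x → 0ℤ < k → c * k ≤ x → c ≤ x ÷ k
c*k≤x⇒c≤x÷k {k} x 0<k ck≤x = i<suc[j]⇒i≤j
  (*-cancelʳ-<-nonNeg k {{nonNegative (<⇒≤ 0<k)}} (≤-<-trans ck≤x (x<suc[x÷k]*k x 0<k)))

x≡c*k⇒x÷k≡c : 0ℤ < k → x ≡ c * k → x ÷ k ≡ c
x≡c*k⇒x÷k≡c {k} {x} {c} 0<k x≡ck = ≤-antisym
  (*-cancelʳ-≤-pos (x ÷ k) c k {{positive 0<k}} (subst (x ÷ k * k ≤_) x≡ck ([x÷k]*k≤x x 0<k)))
  (c*k≤x⇒c≤x÷k x 0<k (≤-reflexive (sym x≡ck)))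

∣⇒[x÷k]*k≡x : 0ℤ < k → k ∣ x → x ÷ k * k ≡ x
∣⇒[x÷k]*k≡x {k} {x} 0<k k∣x = trans (cong (_* k) (x≡c*k⇒x÷k≡c {c = quotient} 0<k equality)) (sym equality)
  where open S._∣_ (S.∣ᵤ⇒∣ {k} {x} k∣x)

x≤⌈x÷k⌉*k : ∀ x → 0ℤ < k → x ≤ ⌈ x ÷ k ⌉ * k
x≤⌈x÷k⌉*k {k} x 0<k = begin
  x                  ≡⟨ sym (neg-involutive x) ⟩
  - (- x)            ≤⟨ neg-mono-≤ ([x÷k]*k≤x (- x) 0<k) ⟩
  - ((- x) ÷ k * k)  ≡⟨ neg-distribˡ-* ((- x) ÷ k) k ⟩
  ⌈ x ÷ k ⌉ * k      ∎
  where open ≤-Reasoning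

x≤c*k⇒⌈x÷k⌉≤c : ∀ x → 0ℤ < k → x ≤ c * k → ⌈ x ÷ k ⌉ ≤ c
x≤c*k⇒⌈x÷k⌉≤c {k} {c} x 0<k x≤ck = begin
  - ((- x) ÷ k)  ≤⟨ neg-mono-≤ (c*k≤x⇒c≤x÷k (- x) 0<k -ck≤-x) ⟩
  - (- c)        ≡⟨ neg-involutive c ⟩
  c              ∎
  where
  open ≤-Reasoning
  -ck≤-x : - c * k ≤ - x
  -ck≤-x = subst (_≤ - x) (neg-distribˡ-* c k) (neg-mono-≤ x≤ck)

⌈÷⌉-window : ∀ x → 0ℤ < k → x ≤ (c + h) * k → c * k < x →
             ⌈ x ÷ k ⌉ - h ≤ c × c ≤ ⌈ x ÷ k ⌉ - 1ℤ
⌈÷⌉-window {k} {c} x 0<k x≤[c+h]k ck<x =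
  i≤j+k⇒i-k≤j (x≤c*k⇒⌈x÷k⌉≤c x 0<k x≤[c+h]k) , i<j⇒i≤j-1 c<⌈x÷k⌉
  where
  c<⌈x÷k⌉ : c < ⌈ x ÷ k ⌉
  c<⌈x÷k⌉ = ≰⇒> λ ⌈x÷k⌉≤c → >⇒≰ ck<x
    (≤-trans (x≤⌈x÷k⌉*k x 0<k) (*-monoʳ-≤-nonNeg k {{nonNegative (<⇒≤ 0<k)}} ⌈x÷k⌉≤c))

window⇒0<h : ∀ C h → C - h ≤ a → a ≤ C - 1ℤ → 0ℤ < h
window⇒0<h C h lo hi = suc[i]≤j⇒i<j (0≤i-j⇒j≤i (subst (0ℤ ≤_) width (i≤j⇒0≤j-i (≤-trans lo hi))))
  where
  width : C - 1ℤ - (C - h) ≡ h - 1ℤ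
  width = solve (C ∷ h ∷ [])

window-width : ∀ C h → C - h ≤ a → c ≤ C - 1ℤ → c - a < h
window-width {a} {c} C h aLo cHi = i≤pred[j]⇒i<j (begin
  c - a                ≤⟨ +-mono-≤ cHi (neg-mono-≤ aLo) ⟩
  C - 1ℤ - (C - h)     ≡⟨ solve (C ∷ h ∷ []) ⟩
  -1ℤ + h              ∎)
  where open ≤-Reasoning

window-unique : ∀ C h → C - h ≤ a → a ≤ C - 1ℤ → C - h ≤ c → c ≤ C - 1ℤ → h ∣ a - c → a ≡ c
window-unique {a} {c} C h aLo aHi cLo cHi h∣a-c = i-j≡0⇒i≡j a c (begin
  a - c         ≡⟨ equality ⟩
  quotient * h  ≡⟨ cong (_* h) q≡0 ⟩
  0ℤ            ∎)
  where
  open ≡-Reasoning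
  open S._∣_ (S.∣ᵤ⇒∣ {h} {a - c} h∣a-c)
  -h<a-c : - h < a - c
  -h<a-c = subst (- h <_) neg[c-a] (neg-mono-< (window-width C h aLo cHi))
    where
    neg[c-a] : - (c - a) ≡ a - c
    neg[c-a] = solve (a ∷ c ∷ [])
  q≡0 : quotient ≡ 0ℤ
  q≡0 = -n<t*n<n⇒t≡0 (window⇒0<h C h aLo aHi)
    (subst (- h <_) equality -h<a-c) (subst (_< h) equality (window-width C h cLo aHi))

coprime⇒∣-cancel : ∀ e → gcd h k ≡ 1ℤ → h ∣ k * a + e → h ∣ k * c + e → h ∣ a - c
coprime⇒∣-cancel {h} {k} {a} {c} e gcd≡1 h∣ka+e h∣kc+e =
  coprime-divisor h k (a - c) (gcd≡1⇒coprime (+-injective gcd≡1)) (S.∣⇒∣ᵤ h∣k[a-c])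
  where
  difference : k * a + e - (k * c + e) ≡ k * (a - c)
  difference = solve (k ∷ a ∷ c ∷ e ∷ [])
  h∣k[a-c] : h S.∣ k * (a - c)
  h∣k[a-c] = subst (h S.∣_) difference (S.∣m∣n⇒∣m-n (S.∣ᵤ⇒∣ {h} {k * a + e} h∣ka+e) (S.∣ᵤ⇒∣ {h} {k * c + e} h∣kc+e))

bezout⇒gcd≡1 : ∀ u v → u * x + v * y ≡ 1ℤ → gcd x y ≡ 1ℤ
bezout⇒gcd≡1 {x} {y} u v bezout = cong +_ (ℕ.∣1⇒≡1 (S.∣⇒∣ᵤ (subst (gcd x y S.∣_) bezout g∣ux+vy)))
  where
  g∣ux+vy : gcd x y S.∣ u * x + v * y
  g∣ux+vy = S.∣m∣n⇒∣m+n (S.∣n⇒∣m*n u (S.∣ᵤ⇒∣ (gcd[i,j]∣i x y))) (S.∣n⇒∣m*n v (S.∣ᵤ⇒∣ (gcd[i,j]∣j x y)))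

gcd[i,i]≡1⇒i≡1 : 0ℤ ≤ i → gcd i i ≡ 1ℤ → i ≡ 1ℤ
gcd[i,i]≡1⇒i≡1 {i} 0≤i gcd≡1 =
  trans (sym (0≤i⇒+∣i∣≡i 0≤i)) (cong +_ (ℕ.∣1⇒≡1 (subst (i ∣_) gcd≡1 (gcd-greatest {i} {i} {i} ℕ.∣-refl ℕ.∣-refl))))

unimodular-between⇒y+k≤v : h * y - x * k ≡ 1ℤ → 0ℤ ≤ y → 0ℤ ≤ k →
                           FracLt x y u v → FracLt u v h k → y + k ≤ v
unimodular-between⇒y+k≤v {h} {y} {x} {k} {u} {v} det 0≤y 0≤k xv<uy uk<hv = begin
  y + k                                      ≡⟨ solve (y ∷ k ∷ []) ⟩
  y * 1ℤ + k * 1ℤ                            ≤⟨ +-mono-≤ (*-monoˡ-≤-nonNeg y {{nonNegative 0≤y}} (i<j⇒1≤j-i uk<hv))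
                                                         (*-monoˡ-≤-nonNeg k {{nonNegative 0≤k}} (i<j⇒1≤j-i xv<uy)) ⟩
  y * (h * v - u * k) + k * (u * y - x * v)  ≡⟨ solve (h ∷ y ∷ x ∷ k ∷ u ∷ v ∷ []) ⟩
  v * (h * y - x * k)                        ≡⟨ cong (v *_) det ⟩
  v * 1ℤ                                     ≡⟨ *-identityʳ v ⟩
  v                                          ∎
  where open ≤-Reasoning

unimodular⇒precedes : InFarey m x y → InFarey m h k → h * y - x * k ≡ 1ℤ → m < y + k → Precedes m x y h k
unimodular⇒precedes {m} {x} {y} {h} {k} Fxy@(_ , _ , 1≤y , _) Fhk@(_ , _ , 1≤k , _) det m<y+k =
  Fxy , Fhk , xk<hy , λ { u v (_ , _ , _ , v≤m , _) (xv<uy , uk<hv) →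
    >⇒≰ m<y+k (≤-trans (unimodular-between⇒y+k≤v {h} {y} {x} {k} {u} {v} det (1≤i⇒0≤i 1≤y) (1≤i⇒0≤i 1≤k) xv<uy uk<hv) v≤m) }
  where
  xk<hy : x * k < h * y
  xk<hy = suc[i]≤j⇒i<j (≤-reflexive (begin
    1ℤ + x * k                ≡⟨ cong (_+ x * k) (sym det) ⟩
    h * y - x * k + x * k     ≡⟨ solve (h ∷ y ∷ x ∷ k ∷ []) ⟩
    h * y                     ∎))
    where open ≡-Reasoning

-- ε = 1 is the situation of part (i) and ε = −1 that of part (ii).
congruent-in-window⇒quotient : ∀ {X} ε → InFarey m h k → X ≡ h * m + (1ℤ - ε) →
  h ∣ k * a + ε → ⌈ X ÷ k ⌉ - h ≤ a → a ≤ ⌈ X ÷ k ⌉ - 1ℤ →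
  k ∣ h * b - ε → m - k + 1ℤ ≤ b → b ≤ m →
  a * k ≡ h * b - ε
congruent-in-window⇒quotient {m} {h} {k} {a} {b} {X} ε (0≤h , _ , 1≤k , _ , gcd≡1) X≡ h∣ka+ε aLo aHi k∣hb-ε bLo bHi =
  trans (cong (_* k) (window-unique ⌈ X ÷ k ⌉ h aLo aHi a₀Lo a₀Hi h∣a-a₀)) a₀k≡hb-ε
  where
  0<k : 0ℤ < k
  0<k = suc[i]≤j⇒i<j 1≤k
  instance
    h≥0 : NonNegative h
    h≥0 = nonNegative 0≤h
  a₀ : ℤ
  a₀ = (h * b - ε) ÷ k
  a₀k≡hb-ε : a₀ * k ≡ h * b - ε
  a₀k≡hb-ε = ∣⇒[x÷k]*k≡x 0<k k∣hb-ε
  a₀k<X : a₀ * k < X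
  a₀k<X = begin-strict
    a₀ * k              ≡⟨ a₀k≡hb-ε ⟩
    h * b - ε           ≤⟨ +-monoˡ-≤ (- ε) (*-monoˡ-≤-nonNeg h bHi) ⟩
    h * m - ε           <⟨ i<i+1 (h * m - ε) ⟩
    h * m - ε + 1ℤ      ≡⟨ solve (h ∷ m ∷ ε ∷ []) ⟩
    h * m + (1ℤ - ε)    ≡⟨ sym X≡ ⟩
    X                   ∎
    where open ≤-Reasoning
  X≤[a₀+h]k : X ≤ (a₀ + h) * k
  X≤[a₀+h]k = begin
    X                              ≡⟨ X≡ ⟩
    h * m + (1ℤ - ε)               ≤⟨ +-monoʳ-≤ (h * m) (+-monoˡ-≤ (- ε) (i<j⇒suc[i]≤j (window⇒0<h ⌈ X ÷ k ⌉ h aLo aHi))) ⟩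
    h * m + (h - ε)                ≡⟨ solve (h ∷ m ∷ k ∷ ε ∷ []) ⟩
    h * (m - k + 1ℤ) + (h * k - ε) ≤⟨ +-monoˡ-≤ (h * k - ε) (*-monoˡ-≤-nonNeg h bLo) ⟩
    h * b + (h * k - ε)            ≡⟨ solve (h ∷ b ∷ k ∷ ε ∷ []) ⟩
    (h * b - ε) + h * k            ≡⟨ cong (_+ h * k) (sym a₀k≡hb-ε) ⟩
    a₀ * k + h * k                 ≡⟨ sym (*-distribʳ-+ k a₀ h) ⟩
    (a₀ + h) * k                   ∎
    where open ≤-Reasoning
  a₀Lo : ⌈ X ÷ k ⌉ - h ≤ a₀
  a₀Lo = proj₁ (⌈÷⌉-window X 0<k X≤[a₀+h]k a₀k<X)
  a₀Hi : a₀ ≤ ⌈ X ÷ k ⌉ - 1ℤ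
  a₀Hi = proj₂ (⌈÷⌉-window X 0<k X≤[a₀+h]k a₀k<X)
  h∣a-a₀ : h ∣ a - a₀
  h∣a-a₀ = coprime⇒∣-cancel {h} {k} {a} {a₀} ε gcd≡1 h∣ka+ε (S.∣⇒∣ᵤ (S.divides b ka₀+ε≡bh))
    where
    ka₀+ε≡bh : k * a₀ + ε ≡ b * h
    ka₀+ε≡bh = begin
      k * a₀ + ε     ≡⟨ cong (_+ ε) (*-comm k a₀) ⟩
      a₀ * k + ε     ≡⟨ cong (_+ ε) a₀k≡hb-ε ⟩
      h * b - ε + ε  ≡⟨ solve (h ∷ b ∷ ε ∷ []) ⟩
      b * h          ∎
      where open ≡-Reasoning

preceding-neighbour : InFarey m h k →
  h ∣ k * a + 1ℤ → ⌈ h * m ÷ k ⌉ - h ≤ a → a ≤ ⌈ h * m ÷ k ⌉ - 1ℤ →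
  k ∣ h * b - 1ℤ → m - k + 1ℤ ≤ b → b ≤ m →
  (a ≡ (h * b - 1ℤ) ÷ k) × ((k * a + 1ℤ) ÷ h ≡ b) × Precedes m a ((k * a + 1ℤ) ÷ h) h k
preceding-neighbour {m} {h} {k} {a} {b} Fhk@(_ , h≤k , 1≤k , k≤m , _) h∣ka+1 aLo aHi k∣hb-1 bLo bHi =
  sym (x≡c*k⇒x÷k≡c 0<k (sym ak≡hb-1)) , [ka+1]÷h≡b ,
  subst (λ y → Precedes m a y h k) (sym [ka+1]÷h≡b) (unimodular⇒precedes Fab Fhk det (m-k+1≤b⇒m<b+k bLo))
  where
  0<k : 0ℤ < k
  0<k = suc[i]≤j⇒i<j 1≤k
  0<h : 0ℤ < h
  0<h = window⇒0<h ⌈ h * m ÷ k ⌉ h aLo aHi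
  1≤h : 1ℤ ≤ h
  1≤h = i<j⇒suc[i]≤j 0<h
  1≤b : 1ℤ ≤ b
  1≤b = ≤-trans (i≤j⇒1≤j-i+1 k≤m) bLo
  ak≡hb-1 : a * k ≡ h * b - 1ℤ
  ak≡hb-1 = congruent-in-window⇒quotient 1ℤ Fhk (sym (+-identityʳ (h * m))) h∣ka+1 aLo aHi k∣hb-1 bLo bHi
  det : h * b - a * k ≡ 1ℤ
  det = trans (cong (λ t → h * b - t) ak≡hb-1) (solve (h ∷ b ∷ []))
  [ka+1]÷h≡b : (k * a + 1ℤ) ÷ h ≡ b
  [ka+1]÷h≡b = x≡c*k⇒x÷k≡c 0<h
    (trans (cong (_+ 1ℤ) (trans (*-comm k a) ak≡hb-1)) (solve (h ∷ b ∷ [])))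
  0≤a : 0ℤ ≤ a
  0≤a = *-cancelʳ-≤-pos 0ℤ a k {{positive 0<k}}
    (subst (0ℤ ≤_) (sym ak≡hb-1) (i≤j⇒0≤j-i (1≤i*j 1≤h 1≤b)))
  a≤b : a ≤ b
  a≤b = *-cancelʳ-≤-pos a b k {{positive 0<k}} (begin
    a * k      ≡⟨ ak≡hb-1 ⟩
    h * b - 1ℤ ≤⟨ i-j≤i (h * b) 1ℤ ⟩
    h * b      ≤⟨ *-monoʳ-≤-nonNeg b {{nonNegative (1≤i⇒0≤i 1≤b)}} h≤k ⟩
    k * b      ≡⟨ *-comm k b ⟩
    b * k      ∎)
    where open ≤-Reasoning
  Fab : InFarey m a b
  Fab = 0≤a , a≤b , 1≤b , bHi , bezout⇒gcd≡1 (- k) h bezout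
    where
    bezout : - k * a + h * b ≡ 1ℤ
    bezout = begin
      - k * a + h * b  ≡⟨ solve (a ∷ b ∷ h ∷ k ∷ []) ⟩
      h * b - a * k    ≡⟨ det ⟩
      1ℤ               ∎
      where open ≡-Reasoning

succeeding-neighbour : InFarey m h k → (h , k) ≢ (1ℤ , 1ℤ) →
  h ∣ k * a - 1ℤ → ⌈ (h * m + + 2) ÷ k ⌉ - h ≤ a → a ≤ ⌈ (h * m + + 2) ÷ k ⌉ - 1ℤ →
  k ∣ h * b + 1ℤ → m - k + 1ℤ ≤ b → b ≤ m →
  (a ≡ (h * b + 1ℤ) ÷ k) × ((k * a - 1ℤ) ÷ h ≡ b) × Succeeds m a ((k * a - 1ℤ) ÷ h) h k
succeeding-neighbour {m} {h} {k} {a} {b} Fhk@(0≤h , h≤k , 1≤k , k≤m , gcd≡1) h,k≢1,1 h∣ka-1 aLo aHi k∣hb+1 bLo bHi =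
  sym (x≡c*k⇒x÷k≡c 0<k (sym ak≡hb+1)) , [ka-1]÷h≡b ,
  subst (λ y → Succeeds m a y h k) (sym [ka-1]÷h≡b)
    (unimodular⇒precedes Fhk Fab det (subst (m <_) (+-comm b k) (m-k+1≤b⇒m<b+k bLo)))
  where
  0<k : 0ℤ < k
  0<k = suc[i]≤j⇒i<j 1≤k
  0<h : 0ℤ < h
  0<h = window⇒0<h ⌈ (h * m + + 2) ÷ k ⌉ h aLo aHi
  1≤h : 1ℤ ≤ h
  1≤h = i<j⇒suc[i]≤j 0<h
  1≤b : 1ℤ ≤ b
  1≤b = ≤-trans (i≤j⇒1≤j-i+1 k≤m) bLo
  h<k : h < k
  h<k = ≤∧≢⇒< h≤k λ h≡k → h,k≢1,1 (cong₂ _,_ (trans h≡k (k≡1 h≡k)) (k≡1 h≡k))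
    where
    k≡1 : h ≡ k → k ≡ 1ℤ
    k≡1 h≡k = gcd[i,i]≡1⇒i≡1 (≤-trans 0≤h h≤k) (subst (λ i → gcd i k ≡ 1ℤ) h≡k gcd≡1)
  ak≡hb+1 : a * k ≡ h * b + 1ℤ
  ak≡hb+1 = congruent-in-window⇒quotient -1ℤ Fhk refl h∣ka-1 aLo aHi k∣hb+1 bLo bHi
  det : a * k - h * b ≡ 1ℤ
  det = trans (cong (_- h * b) ak≡hb+1) (solve (h ∷ b ∷ []))
  [ka-1]÷h≡b : (k * a - 1ℤ) ÷ h ≡ b
  [ka-1]÷h≡b = x≡c*k⇒x÷k≡c 0<h
    (trans (cong (_- 1ℤ) (trans (*-comm k a) ak≡hb+1)) (solve (h ∷ b ∷ [])))
  0≤a : 0ℤ ≤ a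
  0≤a = *-cancelʳ-≤-pos 0ℤ a k {{positive 0<k}}
    (subst (0ℤ ≤_) (sym ak≡hb+1) (≤-trans (1≤i⇒0≤i (1≤i*j 1≤h 1≤b)) (i≤i+j (h * b) 1ℤ)))
  a≤b : a ≤ b
  a≤b = *-cancelʳ-≤-pos a b k {{positive 0<k}} (begin
    a * k          ≡⟨ ak≡hb+1 ⟩
    h * b + 1ℤ     ≤⟨ +-monoʳ-≤ (h * b) 1≤b ⟩
    h * b + b      ≡⟨ solve (h ∷ b ∷ []) ⟩
    (1ℤ + h) * b   ≤⟨ *-monoʳ-≤-nonNeg b {{nonNegative (1≤i⇒0≤i 1≤b)}} (i<j⇒suc[i]≤j h<k) ⟩
    k * b          ≡⟨ *-comm k b ⟩
    b * k          ∎)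
    where open ≤-Reasoning
  Fab : InFarey m a b
  Fab = 0≤a , a≤b , 1≤b , bHi , bezout⇒gcd≡1 k (- h) bezout
    where
    bezout : k * a + - h * b ≡ 1ℤ
    bezout = begin
      k * a + - h * b  ≡⟨ solve (a ∷ b ∷ h ∷ k ∷ []) ⟩
      a * k - h * b    ≡⟨ det ⟩
      1ℤ               ∎
      where open ≡-Reasoning

lemma3p1 : (m : ℤ) → 1ℤ < m →
    -- (i)
    (∀ (h k a b : ℤ) → InFarey m h k → (h , k) ≢ (0ℤ , 1ℤ) →
      h ∣ (k * a + 1ℤ) →
      ⌈ h * m ÷ k ⌉ - h ≤ a → a ≤ ⌈ h * m ÷ k ⌉ - 1ℤ →
      k ∣ (h * b - 1ℤ) →
      m - k + 1ℤ ≤ b → b ≤ m →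
      (a ≡ (h * b - 1ℤ) ÷ k) × ((k * a + 1ℤ) ÷ h ≡ b) ×
      Precedes m a ((k * a + 1ℤ) ÷ h) h k)
    ×
    -- (ii)
    (∀ (h k a b : ℤ) → InFarey m h k → (h , k) ≢ (1ℤ , 1ℤ) →
      h ∣ (k * a - 1ℤ) →
      ⌈ (h * m + + 2) ÷ k ⌉ - h ≤ a → a ≤ ⌈ (h * m + + 2) ÷ k ⌉ - 1ℤ →
      k ∣ (h * b + 1ℤ) →
      m - k + 1ℤ ≤ b → b ≤ m →
      (a ≡ (h * b + 1ℤ) ÷ k) × ((k * a - 1ℤ) ÷ h ≡ b) ×
      Succeeds m a ((k * a - 1ℤ) ÷ h) h k)
lemma3p1 m _ = (λ h k a b Fhk _ → preceding-neighbour Fhk)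
             , (λ h k a b Fhk → succeeding-neighbour Fhk)
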